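{- Let $(A;\Rightarrow,1)$ be an algebra of type $(2,0)$ satisfying, for all $x,y,z\in A$: (i) $x\Rightarrow x=1$, $x\Rightarrow 1=1$, $1\Rightarrow x=x$; (ii) $y\Rightarrow(x\Rightarrow y)=1$; (iii) $(x\Rightarrow y)\Rightarrow y=(y\Rightarrow x)\Rightarrow x$; (iv) $(((x\Rightarrow y)\Rightarrow y)\Rightarrow z)\Rightarrow(x\Rightarrow z)=1$. Define $x\le y$ iff $x\Rightarrow y=1$. Then $\le$ is a partial order on $A$, and $(A,\le)$ is a join-semilattice with greatest element $1$ in which $x\vee y=(x\Rightarrow y)\Rightarrow y$ for all $x,y$. Moreover, $x\le y$ implies $y\Rightarrow z\le x\Rightarrow z$, and $((x\Rightarrow y)\Rightarrow y)\Rightarrow y=x\Rightarrow y$ for all $x,y\in A$. -}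

module Defs where

open import Level using (Level)
open import Relation.Binary.PropositionalEquality using (_≡_)

record IsImpAlgebra {a : Level} {A : Set a} (_⇒_ : A → A → A) (𝟙 : A) : Set a where
  field
    x⇒x   : ∀ x → (x ⇒ x) ≡ 𝟙
    x⇒1   : ∀ x → (x ⇒ 𝟙) ≡ 𝟙
    1⇒x   : ∀ x → (𝟙 ⇒ x) ≡ x
    ax-ii  : ∀ x y → (y ⇒ (x ⇒ y)) ≡ 𝟙
    ax-iii : ∀ x y → ((x ⇒ y) ⇒ y) ≡ ((y ⇒ x) ⇒ x)
    ax-iv  : ∀ x y z → ((((x ⇒ y) ⇒ y) ⇒ z) ⇒ (x ⇒ z)) ≡ 𝟙

induced≤ : {a : Level} {A : Set a} → (A → A → A) → A → A → A → Set a
induced≤ _⇒_ 𝟙 x y = (x ⇒ y) ≡ 𝟙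

-- Everything follows from two facts: x ≤ y forces x ∨ y = y (as 1 ⇒ y = y), and
-- axiom (iv) says that (x ∨ y) ⇒ z ≤ x ⇒ z. Together they make ⇒ antitone in its
-- first argument, which yields transitivity and the supremum property of ∨;
-- antisymmetry is the commutativity (iii) of ∨.
module Submission where

open import Defs
open import Level using (Level)
open import Data.Product using (_×_; _,_)
open import Relation.Binary.PropositionalEquality
  using (_≡_; refl; sym; trans; cong; subst; subst₂; isEquivalence; module ≡-Reasoning)
open import Relation.Binary.Definitions using (Maximum)
open import Relation.Binary.Structures using (IsPartialOrder)
open import Relation.Binary.Lattice.Structures using (IsJoinSemilattice)

module ImpAlgebra {a : Level} {A : Set a} (_⇒_ : A → A → A) (𝟙 : A)
                  (isImpAlgebra : IsImpAlgebra _⇒_ 𝟙) where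
  open IsImpAlgebra isImpAlgebra
  open ≡-Reasoning

  _≤_ : A → A → Set a
  _≤_ = induced≤ _⇒_ 𝟙

  _∨_ : A → A → A
  x ∨ y = (x ⇒ y) ⇒ y

  ∨-comm : ∀ x y → x ∨ y ≡ y ∨ x
  ∨-comm = ax-iii

  ≤⇒∨≡ʳ : ∀ {x y} → x ≤ y → x ∨ y ≡ y
  ≤⇒∨≡ʳ {x} {y} x≤y = trans (cong (_⇒ y) x≤y) (1⇒x y)

  𝟙≤⇒≡𝟙 : ∀ {y} → 𝟙 ≤ y → y ≡ 𝟙
  𝟙≤⇒≡𝟙 {y} 𝟙≤y = trans (sym (1⇒x y)) 𝟙≤y

  ≤-antisym : ∀ {x y} → x ≤ y → y ≤ x → x ≡ y
  ≤-antisym {x} {y} x≤y y≤x = begin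
    x      ≡⟨ sym (≤⇒∨≡ʳ y≤x) ⟩
    y ∨ x  ≡⟨ ∨-comm y x ⟩
    x ∨ y  ≡⟨ ≤⇒∨≡ʳ x≤y ⟩
    y      ∎

  ⇒-antitoneˡ : ∀ {x y} z → x ≤ y → (y ⇒ z) ≤ (x ⇒ z)
  ⇒-antitoneˡ {x} {y} z x≤y =
    subst (λ w → (w ⇒ z) ≤ (x ⇒ z)) (≤⇒∨≡ʳ x≤y) (ax-iv x y z)

  ≤-trans : ∀ {x y z} → x ≤ y → y ≤ z → x ≤ z
  ≤-trans {x} {y} {z} x≤y y≤z =
    𝟙≤⇒≡𝟙 (subst (_≤ (x ⇒ z)) y≤z (⇒-antitoneˡ z x≤y))

  x≤x∨y : ∀ x y → x ≤ (x ∨ y)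
  x≤x∨y x y = 𝟙≤⇒≡𝟙 (subst (_≤ (x ⇒ (x ∨ y))) (x⇒x (x ∨ y)) (ax-iv x y (x ∨ y)))

  y≤x∨y : ∀ x y → y ≤ (x ∨ y)
  y≤x∨y x y = ax-ii (x ⇒ y) y

  ∨-monoˡ-≤ : ∀ {x y} z → x ≤ y → (x ∨ z) ≤ (y ∨ z)
  ∨-monoˡ-≤ z x≤y = ⇒-antitoneˡ z (⇒-antitoneˡ z x≤y)

  ∨-least : ∀ {x y z} → x ≤ z → y ≤ z → (x ∨ y) ≤ z
  ∨-least {x} {y} {z} x≤z y≤z =
    subst₂ _≤_ (∨-comm y x) (trans (∨-comm z x) (≤⇒∨≡ʳ x≤z)) (∨-monoˡ-≤ x y≤z)

  ∨⇒≡⇒ : ∀ x y → ((x ∨ y) ⇒ y) ≡ (x ⇒ y)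
  ∨⇒≡⇒ x y = ≤-antisym (⇒-antitoneˡ y (x≤x∨y x y)) (x≤x∨y (x ⇒ y) y)

  ≤-isPartialOrder : IsPartialOrder _≡_ _≤_
  ≤-isPartialOrder = record
    { isPreorder = record
      { isEquivalence = isEquivalence
      ; reflexive     = λ { {x} refl → x⇒x x }
      ; trans         = ≤-trans
      }
    ; antisym = ≤-antisym
    }

  ∨-isJoinSemilattice : IsJoinSemilattice _≡_ _≤_ _∨_
  ∨-isJoinSemilattice = record
    { isPartialOrder = ≤-isPartialOrder
    ; supremum       = λ x y → x≤x∨y x y , y≤x∨y x y , λ z → ∨-least
    }

  𝟙-maximum : Maximum _≤_ 𝟙
  𝟙-maximum = x⇒1

proposition5 : {a : Level} {A : Set a} (_⇒_ : A → A → A) (𝟙 : A) → IsImpAlgebra _⇒_ 𝟙 →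
    IsJoinSemilattice _≡_ (induced≤ _⇒_ 𝟙) (λ x y → (x ⇒ y) ⇒ y)
    × Maximum (induced≤ _⇒_ 𝟙) 𝟙
    × (∀ x y z → induced≤ _⇒_ 𝟙 x y → induced≤ _⇒_ 𝟙 (y ⇒ z) (x ⇒ z))
    × (∀ x y → (((x ⇒ y) ⇒ y) ⇒ y) ≡ (x ⇒ y))
proposition5 _⇒_ 𝟙 isImpAlgebra =
  ∨-isJoinSemilattice , 𝟙-maximum , (λ x y z → ⇒-antitoneˡ z) , ∨⇒≡⇒
  where open ImpAlgebra _⇒_ 𝟙 isImpAlgebra
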